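{- Let $G$ be a connected graph on $n$ vertices and $m$ edges with maximum degree $\Delta$, and suppose exactly $k$ vertices have degree $\Delta$, where $k<n$. Then $$\sigma_{t}(G)\geq \frac{k}{n-k}\,(n\Delta-2m)^{2}.$$ Equality holds if and only if the $n-k$ vertices not of maximum degree all have degree $\frac{2m-k\Delta}{n-k}$.
   Context: For a finite simple graph $G$ with $d(v)$ the degree of $v$, $\sigma_{t}(G)=\sum_{\{u,v\}\subseteq V(G)}(d(u)-d(v))^{2}$, summing over all unordered pairs of distinct vertices. -}

module Defs where

open import Data.Nat using (ℕ; zero; suc; _<_; _<ᵇ_)
open import Data.Bool using (Bool; true; false; if_then_else_; T)
open import Data.Fin using (Fin; toℕ)
open import Data.List using (List; map; allFin; filter; length)
open import Data.Nat.ListAction using (sum)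
open import Data.Integer using (ℤ; +_; _-_; _*_)
import Data.Integer as ℤ
open import Relation.Binary.PropositionalEquality using (_≡_)
open import Relation.Nullary using (¬_)
open import Data.Nat using (_≟_; _≤_)
open import Relation.Nullary.Decidable using (⌊_⌋)
open import Data.Product using (_×_; Σ)
open import Data.Bool using (T?)
open import Data.List using (foldr)

sumℤ : List ℤ → ℤ
sumℤ = foldr ℤ._+_ (+ 0)

record Graph (n : ℕ) : Set where
  field
    adj     : Fin n → Fin n → Bool
    symm    : ∀ i j → adj i j ≡ adj j i
    irrefl  : ∀ i → adj i i ≡ false
open Graph public

countFin : (n : ℕ) → (Fin n → Bool) → ℕ
countFin n p = length (filter (λ i → T? (p i)) (allFin n))

deg : ∀ {n} → Graph n → Fin n → ℕ
deg {n} G v = countFin n (adj G v)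

edgeCount : ∀ {n} → Graph n → ℕ
edgeCount {n} G =
  sum (map (λ i → countFin n (λ j → if toℕ i <ᵇ toℕ j then adj G i j else false)) (allFin n))

data Reachable {n : ℕ} (G : Graph n) : Fin n → Fin n → Set where
  here : ∀ {i} → Reachable G i i
  step : ∀ {i j l} → adj G i j ≡ true → Reachable G j l → Reachable G i l

Connected : ∀ {n} → Graph n → Set
Connected G = ∀ i j → Reachable G i j

IsMaxDegree : ∀ {n} → Graph n → ℕ → Set
IsMaxDegree {n} G Δ = (∀ v → deg G v ≤ Δ) × Σ (Fin n) (λ v → deg G v ≡ Δ)

countDeg : ∀ {n} → Graph n → ℕ → ℕ
countDeg {n} G Δ = countFin n (λ v → ⌊ deg G v ≟ Δ ⌋)

sigmaT : ∀ {n} → Graph n → ℤ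
sigmaT {n} G =
  sumℤ (map (λ i → sumℤ (map (λ j →
      if toℕ i <ᵇ toℕ j
        then (+ deg G i - + deg G j) * (+ deg G i - + deg G j)
        else + 0) (allFin n))) (allFin n))

{-# OPTIONS --safe #-}
module Submission where

-- Let t = n − k count the vertices whose degree d(v) differs from Δ, and let
-- a = 2m − kΔ be their degree sum.  Lagrange's identity gives
-- σ_t = n Σ d(v)² − (Σ d(v))², and a direct computation then yields
--   t (t σ_t − k (nΔ − 2m)²) = n Σ_{d(v) ≠ Δ} (t d(v) − a)²,
-- a sum of squares that vanishes exactly when every such vertex has t d(v) = a.

open import Defs
open import Data.Bool using (Bool; true; false; if_then_else_; T?)
open import Data.Bool.Properties using (if-float)
open import Data.Empty using (⊥-elim)
open import Data.Fin using (Fin; zero; suc; toℕ)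
open import Data.Fin.Properties using (toℕ-injective)
open import Data.Integer using (ℤ; 0ℤ; +_; -_; _+_; _-_; _*_; _≤_; +≤+; +<+)
import Data.Integer.Base as ℤ
import Data.Integer.Properties as ℤ
open import Data.Integer.Tactic.RingSolver using (solve-∀)
open import Algebra.Properties.Semiring.Sum ℤ.+-*-semiring
  using (sum-syntax; sum-cong-≗; ∑-distrib-+; ∑-comm; *-distribˡ-sum)
  renaming (sum to ∑)
open import Data.List using (List; []; _∷_; map; filter; length; allFin; tabulate)
open import Data.List.Properties using (map-tabulate)
open import Data.Nat using (ℕ; _<_; _∸_; _<ᵇ_; _≟_; z≤n)
import Data.Nat.Base as ℕ
import Data.Nat.Properties as ℕ
open import Data.Nat.ListAction using (sum)
open import Data.Product using (_×_; _,_)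
open import Data.Sum using (reduce)
open import Function using (_∘_; id)
open import Function.Bundles using (_⇔_; mk⇔; Equivalence)
open import Function.Construct.Composition using (_⇔-∘_)
open import Relation.Binary.PropositionalEquality
  using (_≡_; _≢_; refl; sym; trans; cong; cong₂; module ≡-Reasoning)
open import Relation.Nullary using (yes; no)
open import Relation.Nullary.Decidable using (⌊_⌋)
open import Relation.Nullary.Reflects using (ofʸ; ofⁿ)

sumℤ-tabulate : ∀ {n} (f : Fin n → ℤ) → sumℤ (tabulate f) ≡ ∑ f
sumℤ-tabulate {ℕ.zero} f = refl
sumℤ-tabulate {ℕ.suc n} f = cong (λ s → f zero + s) (sumℤ-tabulate (f ∘ suc))

sumℤ-map-allFin : ∀ {n} (f : Fin n → ℤ) → sumℤ (map f (allFin n)) ≡ ∑[ i < n ] f i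
sumℤ-map-allFin f = trans (cong sumℤ (map-tabulate id f)) (sumℤ-tabulate f)

+-sum-map : {A : Set} (f : A → ℕ) (xs : List A) → + sum (map f xs) ≡ sumℤ (map (+_ ∘ f) xs)
+-sum-map f [] = refl
+-sum-map f (x ∷ xs) = cong (λ s → + f x + s) (+-sum-map f xs)

𝟙 : Bool → ℤ
𝟙 b = if b then + 1 else + 0

+-length-filter : {A : Set} (p : A → Bool) (xs : List A) →
  + length (filter (T? ∘ p) xs) ≡ sumℤ (map (𝟙 ∘ p) xs)
+-length-filter p [] = refl
+-length-filter p (x ∷ xs) with p x
... | true  = cong (λ s → + 1 + s) (+-length-filter p xs)
... | false = trans (+-length-filter p xs) (sym (ℤ.+-identityˡ _))

+-countFin : ∀ n (p : Fin n → Bool) → + countFin n p ≡ ∑[ i < n ] 𝟙 (p i)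
+-countFin n p = trans (+-length-filter p (allFin n)) (sumℤ-map-allFin (𝟙 ∘ p))

∑-const : ∀ n (c : ℤ) → ∑[ i < n ] c ≡ + n * c
∑-const ℕ.zero c = sym (ℤ.*-zeroˡ c)
∑-const (ℕ.suc n) c = begin
  c + ∑[ i < n ] c        ≡⟨ cong (λ s → c + s) (∑-const n c) ⟩
  c + + n * c             ≡⟨ cong (_+ + n * c) (ℤ.*-identityˡ c) ⟨
  + 1 * c + + n * c       ≡⟨ ℤ.*-distribʳ-+ c (+ 1) (+ n) ⟨
  + ℕ.suc n * c           ∎
  where open ≡-Reasoning

∑-quadratic : ∀ n (α β γ : ℤ) (x : Fin n → ℤ) →
  ∑[ i < n ] (α * (x i * x i) + β * x i + γ)
    ≡ α * ∑[ i < n ] (x i * x i) + β * ∑[ i < n ] x i + + n * γ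
∑-quadratic n α β γ x = begin
  ∑[ i < n ] (α * (x i * x i) + β * x i + γ)
    ≡⟨ ∑-distrib-+ (λ i → α * (x i * x i) + β * x i) (λ _ → γ) ⟩
  ∑[ i < n ] (α * (x i * x i) + β * x i) + ∑[ i < n ] γ
    ≡⟨ cong₂ _+_ (∑-distrib-+ (λ i → α * (x i * x i)) (λ i → β * x i)) (∑-const n γ) ⟩
  ∑[ i < n ] (α * (x i * x i)) + ∑[ i < n ] (β * x i) + + n * γ
    ≡⟨ cong (_+ + n * γ) (cong₂ _+_ (*-distribˡ-sum α (λ i → x i * x i)) (*-distribˡ-sum β x)) ⟨
  α * ∑[ i < n ] (x i * x i) + β * ∑[ i < n ] x i + + n * γ
    ∎
  where open ≡-Reasoning

0≤i*i : ∀ i → 0ℤ ≤ i * i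
0≤i*i ℤ.+0       = +≤+ z≤n
0≤i*i ℤ.+[1+ n ] = +≤+ z≤n
0≤i*i ℤ.-[1+ n ] = +≤+ z≤n

i*i≡0⇒i≡0 : ∀ i → i * i ≡ 0ℤ → i ≡ 0ℤ
i*i≡0⇒i≡0 i i*i≡0 = reduce (ℤ.i*j≡0⇒i≡0∨j≡0 i i*i≡0)

nonNeg+nonNeg≡0 : ∀ {i j} → 0ℤ ≤ i → 0ℤ ≤ j → i + j ≡ 0ℤ → i ≡ 0ℤ × j ≡ 0ℤ
nonNeg+nonNeg≡0 {+ m} (+≤+ _) (+≤+ _) m+n≡0 =
  cong +_ (ℕ.m+n≡0⇒m≡0 m (ℤ.+-injective m+n≡0)) , cong +_ (ℕ.m+n≡0⇒n≡0 m (ℤ.+-injective m+n≡0))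

∑-nonNeg : ∀ n (f : Fin n → ℤ) → (∀ i → 0ℤ ≤ f i) → 0ℤ ≤ ∑ f
∑-nonNeg ℕ.zero    f 0≤f = ℤ.≤-refl
∑-nonNeg (ℕ.suc n) f 0≤f = ℤ.+-mono-≤ (0≤f zero) (∑-nonNeg n (f ∘ suc) (0≤f ∘ suc))

∑-nonNeg≡0⇒≡0 : ∀ n (f : Fin n → ℤ) → (∀ i → 0ℤ ≤ f i) → ∑ f ≡ 0ℤ → ∀ i → f i ≡ 0ℤ
∑-nonNeg≡0⇒≡0 (ℕ.suc n) f 0≤f ∑f≡0 =
  let f₀≡0 , ∑tail≡0 = nonNeg+nonNeg≡0 (0≤f zero) (∑-nonNeg n (f ∘ suc) (0≤f ∘ suc)) ∑f≡0 in
  λ where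
    zero    → f₀≡0
    (suc i) → ∑-nonNeg≡0⇒≡0 n (f ∘ suc) (0≤f ∘ suc) ∑tail≡0 i

∑-nonNeg≡0⇔≡0 : ∀ n (f : Fin n → ℤ) → (∀ i → 0ℤ ≤ f i) → (∑ f ≡ 0ℤ ⇔ (∀ i → f i ≡ 0ℤ))
∑-nonNeg≡0⇔≡0 n f 0≤f = mk⇔ (∑-nonNeg≡0⇒≡0 n f 0≤f)
  (λ f≡0 → trans (sum-cong-≗ f≡0) (trans (∑-const n 0ℤ) (ℤ.*-zeroʳ (+ n))))

module _ {n : ℕ} where

  upper : (Fin n → Fin n → ℤ) → Fin n → Fin n → ℤ
  upper h i j = if toℕ i <ᵇ toℕ j then h i j else 0ℤ

  ∑< : (Fin n → Fin n → ℤ) → ℤ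
  ∑< h = ∑[ i < n ] ∑[ j < n ] upper h i j

  upper-split : (h : Fin n → Fin n → ℤ) → (∀ i j → h i j ≡ h j i) → (∀ i → h i i ≡ 0ℤ) →
    ∀ i j → h i j ≡ upper h i j + upper h j i
  upper-split h sym-h h-diag i j
    with toℕ i <ᵇ toℕ j | ℕ.<ᵇ-reflects-< (toℕ i) (toℕ j)
       | toℕ j <ᵇ toℕ i | ℕ.<ᵇ-reflects-< (toℕ j) (toℕ i)
  ... | true  | ofʸ i<j | true  | ofʸ j<i = ⊥-elim (ℕ.<-asym i<j j<i)
  ... | true  | _       | false | _       = sym (ℤ.+-identityʳ (h i j))
  ... | false | _       | true  | _       = trans (sym-h i j) (sym (ℤ.+-identityˡ (h j i)))
  ... | false | ofⁿ i≮j | false | ofⁿ j≮i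
    rewrite toℕ-injective (ℕ.≤-antisym (ℕ.≮⇒≥ j≮i) (ℕ.≮⇒≥ i≮j)) = h-diag j

  ∑∑-symmetric : (h : Fin n → Fin n → ℤ) → (∀ i j → h i j ≡ h j i) → (∀ i → h i i ≡ 0ℤ) →
    ∑[ i < n ] ∑[ j < n ] h i j ≡ + 2 * ∑< h
  ∑∑-symmetric h sym-h h-diag = begin
    ∑[ i < n ] ∑[ j < n ] h i j
      ≡⟨ sum-cong-≗ (λ i → sum-cong-≗ (upper-split h sym-h h-diag i)) ⟩
    ∑[ i < n ] ∑[ j < n ] (upper h i j + upper h j i)
      ≡⟨ sum-cong-≗ (λ i → ∑-distrib-+ (upper h i) (λ j → upper h j i)) ⟩
    ∑[ i < n ] (∑[ j < n ] upper h i j + ∑[ j < n ] upper h j i)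
      ≡⟨ ∑-distrib-+ (λ i → ∑[ j < n ] upper h i j) (λ i → ∑[ j < n ] upper h j i) ⟩
    ∑< h + ∑[ i < n ] ∑[ j < n ] upper h j i
      ≡⟨ cong (λ s → ∑< h + s) (∑-comm (upper h)) ⟨
    ∑< h + ∑< h
      ≡⟨ double (∑< h) ⟩
    + 2 * ∑< h
      ∎
    where
    open ≡-Reasoning
    double : ∀ s → s + s ≡ + 2 * s
    double = solve-∀

  σₜ : (Fin n → ℤ) → ℤ
  σₜ x = ∑< (λ i j → (x i - x j) * (x i - x j))

  lagrange-identity : (x : Fin n → ℤ) →
    σₜ x ≡ + n * ∑[ i < n ] (x i * x i) - ∑[ i < n ] x i * ∑[ i < n ] x i
  lagrange-identity x = ℤ.*-cancelˡ-≡ (+ 2) _ _ (begin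
    + 2 * σₜ x
      ≡⟨ ∑∑-symmetric (λ i j → (x i - x j) * (x i - x j)) (λ i j → swap (x i) (x j)) (λ i → diag (x i)) ⟨
    ∑[ i < n ] ∑[ j < n ] ((x i - x j) * (x i - x j))
      ≡⟨ sum-cong-≗ inner ⟩
    ∑[ i < n ] (+ n * (x i * x i) + (- (+ 2 * D)) * x i + Q)
      ≡⟨ ∑-quadratic n (+ n) (- (+ 2 * D)) Q x ⟩
    + n * Q + (- (+ 2 * D)) * D + + n * Q
      ≡⟨ collect (+ n) Q D ⟩
    + 2 * (+ n * Q - D * D)
      ∎)
    where
    open ≡-Reasoning
    D Q : ℤ
    D = ∑[ i < n ] x i
    Q = ∑[ i < n ] (x i * x i)
    swap : ∀ u v → (u - v) * (u - v) ≡ (v - u) * (v - u)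
    swap = solve-∀
    diag : ∀ u → (u - u) * (u - u) ≡ 0ℤ
    diag = solve-∀
    expand : ∀ u v → (u - v) * (u - v) ≡ + 1 * (v * v) + (- (+ 2 * u)) * v + u * u
    expand = solve-∀
    regroup : ∀ m u D Q → + 1 * Q + (- (+ 2 * u)) * D + m * (u * u) ≡ m * (u * u) + (- (+ 2 * D)) * u + Q
    regroup = solve-∀
    collect : ∀ m Q D → m * Q + (- (+ 2 * D)) * D + m * Q ≡ + 2 * (m * Q - D * D)
    collect = solve-∀
    inner : ∀ i → ∑[ j < n ] ((x i - x j) * (x i - x j)) ≡ + n * (x i * x i) + (- (+ 2 * D)) * x i + Q
    inner i = begin
      ∑[ j < n ] ((x i - x j) * (x i - x j))
        ≡⟨ sum-cong-≗ (λ j → expand (x i) (x j)) ⟩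
      ∑[ j < n ] (+ 1 * (x j * x j) + (- (+ 2 * x i)) * x j + x i * x i)
        ≡⟨ ∑-quadratic n (+ 1) (- (+ 2 * x i)) (x i * x i) x ⟩
      + 1 * Q + (- (+ 2 * x i)) * D + + n * (x i * x i)
        ≡⟨ regroup (+ n) (x i) D Q ⟩
      + n * (x i * x i) + (- (+ 2 * D)) * x i + Q
        ∎

*-cancelˡ-≡0 : ∀ i {j} .{{_ : ℤ.NonZero i}} → i * j ≡ 0ℤ → j ≡ 0ℤ
*-cancelˡ-≡0 i {j} ij≡0 = ℤ.*-cancelˡ-≡ i j 0ℤ (trans ij≡0 (sym (ℤ.*-zeroʳ i)))

≤-via-nonNeg-gap : ∀ {t m P R W} → 0 < t → 0 < m → 0ℤ ≤ W → + t * (R - P) ≡ + m * W →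
  P ≤ R × (P ≡ R ⇔ W ≡ 0ℤ)
≤-via-nonNeg-gap {t} {m} {P} {R} {W} 0<t 0<m 0≤W gap =
  ℤ.0≤i-j⇒j≤i 0≤R-P , mk⇔ (R-P≡0⇒W≡0 ∘ ℤ.i≡j⇒i-j≡0 ∘ sym) (sym ∘ ℤ.i-j≡0⇒i≡j R P ∘ W≡0⇒R-P≡0)
  where
  instance
    _ : ℤ.Positive (+ t)
    _ = ℤ.positive (+<+ 0<t)
    _ : ℕ.NonZero t
    _ = ℕ.>-nonZero 0<t
    _ : ℕ.NonZero m
    _ = ℕ.>-nonZero 0<m
  0≤R-P : 0ℤ ≤ R - P
  0≤R-P = ℤ.*-cancelˡ-≤-pos 0ℤ (R - P) (+ t) (begin
    + t * 0ℤ       ≡⟨ ℤ.*-zeroʳ (+ t) ⟩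
    0ℤ             ≡⟨ ℤ.*-zeroʳ (+ m) ⟨
    + m * 0ℤ       ≤⟨ ℤ.*-monoˡ-≤-nonNeg (+ m) 0≤W ⟩
    + m * W        ≡⟨ gap ⟨
    + t * (R - P)  ∎)
    where open ℤ.≤-Reasoning
  R-P≡0⇒W≡0 : R - P ≡ 0ℤ → W ≡ 0ℤ
  R-P≡0⇒W≡0 R-P≡0 = *-cancelˡ-≡0 (+ m) (trans (sym gap) (trans (cong (+ t *_) R-P≡0) (ℤ.*-zeroʳ (+ t))))
  W≡0⇒R-P≡0 : W ≡ 0ℤ → R - P ≡ 0ℤ
  W≡0⇒R-P≡0 W≡0 = *-cancelˡ-≡0 (+ t) (trans gap (trans (cong (+ m *_) W≡0) (ℤ.*-zeroʳ (+ m))))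

gap-identity : ∀ {N K t Δ D Q W} → N ≡ K + t →
  let a = D - K * Δ in
  W + (t * Δ - a) * (t * Δ - a) * K ≡ t * t * Q + (- (+ 2 * t * a)) * D + N * (a * a) →
  t * (t * (N * Q - D * D) - K * (N * Δ - D) * (N * Δ - D)) ≡ N * W
gap-identity {K = K} {t} {Δ} {D} {Q} {W} refl W+cK≡ = begin
  t * (t * ((K + t) * Q - D * D) - K * ((K + t) * Δ - D) * ((K + t) * Δ - D))
    ≡⟨ identity K t Δ D Q ⟩
  (K + t) * (t * t * Q + (- (+ 2 * t * a)) * D + (K + t) * (a * a) - c * K)
    ≡⟨ cong (λ s → (K + t) * (s - c * K)) W+cK≡ ⟨
  (K + t) * (W + c * K - c * K)
    ≡⟨ cong ((K + t) *_) (cancel W (c * K)) ⟩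
  (K + t) * W
    ∎
  where
  open ≡-Reasoning
  a c : ℤ
  a = D - K * Δ
  c = (t * Δ - a) * (t * Δ - a)
  identity : ∀ K t Δ D Q → let a = D - K * Δ in
    t * (t * ((K + t) * Q - D * D) - K * ((K + t) * Δ - D) * ((K + t) * Δ - D))
      ≡ (K + t) * (t * t * Q + (- (+ 2 * t * a)) * D + (K + t) * (a * a) - (t * Δ - a) * (t * Δ - a) * K)
  identity = solve-∀
  cancel : ∀ w y → w + y - y ≡ w
  cancel = solve-∀

module DegreeSequence {n : ℕ} (x : Fin n → ℕ) (Δ : ℕ) where

  X : Fin n → ℤ
  X i = + x i

  D Q : ℤ
  D = ∑[ i < n ] X i
  Q = ∑[ i < n ] (X i * X i)

  isΔ : Fin n → Bool
  isΔ i = ⌊ x i ≟ Δ ⌋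

  k : ℕ
  k = countFin n isΔ

  t a : ℤ
  t = + (n ∸ k)
  a = D - + k * + Δ

  c : ℤ
  c = (t * + Δ - a) * (t * + Δ - a)

  excess : Fin n → ℤ
  excess i = if isΔ i then 0ℤ else (t * X i - a) * (t * X i - a)

  square-split : ∀ i → (t * X i - a) * (t * X i - a) ≡ excess i + c * 𝟙 (isΔ i)
  square-split i with x i ≟ Δ
  ... | yes xi≡Δ rewrite xi≡Δ = sym (trans (ℤ.+-identityˡ _) (ℤ.*-identityʳ _))
  ... | no _ = sym (trans (cong (λ s → (t * X i - a) * (t * X i - a) + s) (ℤ.*-zeroʳ c)) (ℤ.+-identityʳ _))

  W : ℤ
  W = ∑ excess

  W+ck≡moments : W + c * + k ≡ t * t * Q + (- (+ 2 * t * a)) * D + + n * (a * a)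
  W+ck≡moments = begin
    W + c * + k
      ≡⟨ cong (λ s → W + c * s) (+-countFin n isΔ) ⟩
    W + c * ∑[ i < n ] 𝟙 (isΔ i)
      ≡⟨ cong (λ s → W + s) (*-distribˡ-sum c (𝟙 ∘ isΔ)) ⟩
    W + ∑[ i < n ] (c * 𝟙 (isΔ i))
      ≡⟨ ∑-distrib-+ excess (λ i → c * 𝟙 (isΔ i)) ⟨
    ∑[ i < n ] (excess i + c * 𝟙 (isΔ i))
      ≡⟨ sum-cong-≗ square-split ⟨
    ∑[ i < n ] ((t * X i - a) * (t * X i - a))
      ≡⟨ sum-cong-≗ (λ i → expand t a (X i)) ⟩
    ∑[ i < n ] (t * t * (X i * X i) + (- (+ 2 * t * a)) * X i + a * a)
      ≡⟨ ∑-quadratic n (t * t) (- (+ 2 * t * a)) (a * a) X ⟩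
    t * t * Q + (- (+ 2 * t * a)) * D + + n * (a * a)
      ∎
    where
    open ≡-Reasoning
    expand : ∀ t a u → (t * u - a) * (t * u - a) ≡ t * t * (u * u) + (- (+ 2 * t * a)) * u + a * a
    expand = solve-∀

  gap≡n*W : k < n → t * (t * σₜ X - + k * (+ n * + Δ - D) * (+ n * + Δ - D)) ≡ + n * W
  gap≡n*W k<n rewrite lagrange-identity X =
    gap-identity {K = + k} {t} {+ Δ} {D} {Q} {W} (cong +_ (sym (ℕ.m+[n∸m]≡n (ℕ.<⇒≤ k<n)))) W+ck≡moments

  excess-nonNeg : ∀ i → 0ℤ ≤ excess i
  excess-nonNeg i with isΔ i
  ... | true  = ℤ.≤-refl
  ... | false = 0≤i*i (t * X i - a)

  excess≡0⇔ : ∀ i → excess i ≡ 0ℤ ⇔ (x i ≢ Δ → t * X i ≡ a)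
  excess≡0⇔ i with x i ≟ Δ
  ... | yes xi≡Δ = mk⇔ (λ _ xi≢Δ → ⊥-elim (xi≢Δ xi≡Δ)) (λ _ → refl)
  ... | no xi≢Δ  = mk⇔ (λ sq≡0 _ → ℤ.i-j≡0⇒i≡j _ _ (i*i≡0⇒i≡0 _ sq≡0))
                       (λ tX≡a → cong (λ s → s * s) (ℤ.i≡j⇒i-j≡0 (tX≡a xi≢Δ)))

  W≡0⇔ : W ≡ 0ℤ ⇔ (∀ i → x i ≢ Δ → t * X i ≡ a)
  W≡0⇔ = mk⇔ (λ W≡0 i → Equivalence.to (excess≡0⇔ i) (Equivalence.to all≡0 W≡0 i))
             (λ tX≡a → Equivalence.from all≡0 (λ i → Equivalence.from (excess≡0⇔ i) (tX≡a i)))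
    where
    all≡0 : W ≡ 0ℤ ⇔ (∀ i → excess i ≡ 0ℤ)
    all≡0 = ∑-nonNeg≡0⇔≡0 n excess excess-nonNeg

  σₜ-bound : k < n →
    (+ k * (+ n * + Δ - D) * (+ n * + Δ - D) ≤ t * σₜ X)
    × (+ k * (+ n * + Δ - D) * (+ n * + Δ - D) ≡ t * σₜ X ⇔ (∀ i → x i ≢ Δ → t * X i ≡ a))
  σₜ-bound k<n =
    let P≤R , P≡R⇔W≡0 = ≤-via-nonNeg-gap (ℕ.m<n⇒0<n∸m k<n) (ℕ.<-≤-trans ℕ.z<s k<n)
                          (∑-nonNeg n excess excess-nonNeg) (gap≡n*W k<n)
    in P≤R , W≡0⇔ ⇔-∘ P≡R⇔W≡0

sigmaT≡σₜ : ∀ {n} (G : Graph n) → sigmaT G ≡ σₜ (λ v → + deg G v)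
sigmaT≡σₜ {n} G = trans (sumℤ-map-allFin (λ i → sumℤ (map (upper h i) (allFin n))))
                         (sum-cong-≗ (λ i → sumℤ-map-allFin (upper h i)))
  where
  h : Fin n → Fin n → ℤ
  h i j = (+ deg G i - + deg G j) * (+ deg G i - + deg G j)

handshake : ∀ {n} (G : Graph n) → ∑[ v < n ] (+ deg G v) ≡ + 2 * + edgeCount G
handshake {n} G = begin
  ∑[ v < n ] (+ deg G v)
    ≡⟨ sum-cong-≗ (λ v → +-countFin n (adj G v)) ⟩
  ∑[ v < n ] ∑[ w < n ] A v w
    ≡⟨ ∑∑-symmetric A (λ v w → cong 𝟙 (symm G v w)) (λ v → cong 𝟙 (irrefl G v)) ⟩
  + 2 * ∑< A
    ≡⟨ cong (λ s → + 2 * s) edges ⟨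
  + 2 * + edgeCount G
    ∎
  where
  open ≡-Reasoning
  A : Fin n → Fin n → ℤ
  A v w = 𝟙 (adj G v w)
  E : Fin n → Fin n → Bool
  E v w = if toℕ v <ᵇ toℕ w then adj G v w else false
  edges : + edgeCount G ≡ ∑< A
  edges = begin
    + edgeCount G
      ≡⟨ +-sum-map (λ v → countFin n (E v)) (allFin n) ⟩
    sumℤ (map (λ v → + countFin n (E v)) (allFin n))
      ≡⟨ sumℤ-map-allFin (λ v → + countFin n (E v)) ⟩
    ∑[ v < n ] (+ countFin n (E v))
      ≡⟨ sum-cong-≗ (λ v → trans (+-countFin n (E v)) (sum-cong-≗ {n} (λ w → if-float 𝟙 (toℕ v <ᵇ toℕ w)))) ⟩
    ∑< A
      ∎

theorem14 : (n : ℕ) (G : Graph n) (m Δ k : ℕ) →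
  Connected G → m ≡ edgeCount G → IsMaxDegree G Δ → k ≡ countDeg G Δ → k < n →
  ((+ k) * ((+ n * + Δ) - (+ 2 * + m)) * ((+ n * + Δ) - (+ 2 * + m)) ≤ + (n ∸ k) * sigmaT G)
  × ((+ k) * ((+ n * + Δ) - (+ 2 * + m)) * ((+ n * + Δ) - (+ 2 * + m)) ≡ + (n ∸ k) * sigmaT G
      ⇔ (∀ (v : Fin n) → deg G v ≢ Δ →
           + (n ∸ k) * + deg G v ≡ (+ 2 * + m) - (+ k * + Δ)))
theorem14 n G .(edgeCount G) Δ .(countDeg G Δ) _ refl _ refl k<n
  rewrite sigmaT≡σₜ G | sym (handshake G) = DegreeSequence.σₜ-bound (deg G) Δ k<n
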